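{- Let $\rho=l\to r$ be a linear term rewrite rule over a signature $\Sigma$ and let $s$ be a linear term. If $\rho^\circ$ is applied at position $p$ in $s^\circ$ via a match $m:l^\circ\rightarrowtail s^\circ$, then there is a unique morphism $\alpha:s^\circ\to\mathcal{C}[l^\circ{\downarrow_\mathcal{X}}]$ such that $\alpha\circ m=t_L$ and the square formed by $1_{l^\circ}:l^\circ\to l^\circ$, $m$, $t_L$ and $\alpha$ is a pullback.
   Context: Signature $\Sigma$ with arities $\#$; terms over $\Sigma$ and variables $\mathcal{X}$; linear terms (each variable at most once); positions are sequences of positive integers ($\epsilon$ root, $pi$ the $i$-th argument below $p$); a rule $l\to r$ has $l\notin\mathcal{X}$, $\mathrm{Var}(r)\subseteq\mathrm{Var}(l)$, linear if $l,r$ are linear. Graphs are objects of $\mathbf{Graph}(\Sigma^\circ)$: graphs $(V,E,s,t,\ell)$ labeled in the flat lattice $\Sigma^\circ=(\Sigma\uplus\mathbb{N}^+)\uplus\{\bot,\top\}$ ($\bot$ least, $\top$ greatest, other elements pairwise incomparable); morphisms are pairs of maps on vertices/edges commuting with source and target and satisfying $\ell(x)\le\ell(\phi(x))$. For a linear term $t$, $t^\circ$ is the graph with a vertex $p$ labeled $f$ for each position $p$ of $t$ holding a function symbol $f$, a vertex $x$ labeled $\bot$ for each variable $x$ of $t$, and for each position $p$ holding a symbol of arity $n$ and $1\le i\le n$ an edge labeled $i$ from the vertex at $p$ to the vertex at $pi$; the root is the vertex at $\epsilon$, and each vertex has the position it corresponds to. The context closure $\mathcal{C}[l^\circ{\downarrow_\mathcal{X}}]$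 is obtained from $l^\circ$ by relabeling each variable vertex $x$ to $\top$ and adding a fresh $\top$-vertex $x'$ with $\top$-edges $x\to x'$ and $x'\to x'$, and adding a fresh $\top$-vertex $\mathcal{C}$ with $\top$-edges from $\mathcal{C}$ to the root and $\mathcal{C}\to\mathcal{C}$. $t_L:l^\circ\rightarrowtail\mathcal{C}[l^\circ{\downarrow_\mathcal{X}}]$ is the inclusion. The rule $\rho^\circ$ is said to be applied at position $p$ in $s^\circ$ if its match, a mono $m:l^\circ\rightarrowtail s^\circ$, maps the root of $l^\circ$ onto the vertex of $s^\circ$ at position $p$ and establishes a match (i.e. is part of a PBPO$^+$ rewrite step: there is $\alpha$ with $\alpha\circ m=t_L$ such that $l^\circ$ with $1_{l^\circ}$ and $m$ is a pullback of $t_L$ and $\alpha$). -}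

module Defs where

open import Data.Nat using (ℕ)
open import Data.Fin using (Fin; toℕ)
open import Data.Bool using (Bool; true; false; T)
open import Data.Unit using (⊤; tt)
open import Data.Empty using (⊥)
open import Data.Maybe using (Maybe; just; nothing)
open import Data.Product using (Σ; _×_; _,_; ∃)
open import Relation.Binary.PropositionalEquality using (_≡_; refl; cong)
open import Relation.Nullary using (¬_)

record Signature : Set₁ where
  field
    Sym   : Set
    arity : Sym → ℕ

module _ (Σ' : Signature) (𝒳 : Set) where
  open Signature Σ'

  data Term : Set where
    var : 𝒳 → Term
    app : (f : Sym) → (Fin (arity f) → Term) → Term

module Terms {Σ' : Signature} {𝒳 : Set} where
  open Signature Σ'

  -- Positions of a term t (ε = here, p·i = argument i below p).
  data Pos : Term Σ' 𝒳 → Set where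
    here  : ∀ {t} → Pos t
    under : ∀ {f ts} (i : Fin (arity f)) → Pos (ts i) → Pos (app f ts)

  subtermAt : (t : Term Σ' 𝒳) → Pos t → Term Σ' 𝒳
  subtermAt t here = t
  subtermAt (app f ts) (under i p) = subtermAt (ts i) p

  varAt : {t : Term Σ' 𝒳} → Pos t → Maybe 𝒳
  varAt {t} p with subtermAt t p
  ... | var x   = just x
  ... | app _ _ = nothing

  isVarPos : {t : Term Σ' 𝒳} → Pos t → Bool
  isVarPos {t} p with subtermAt t p
  ... | var _   = true
  ... | app _ _ = false

  _∈Var_ : 𝒳 → Term Σ' 𝒳 → Set
  x ∈Var t = Σ (Pos t) λ p → varAt p ≡ just x

  Linear : Term Σ' 𝒳 → Set
  Linear t = (p q : Pos t) (x : 𝒳) → varAt p ≡ just x → varAt q ≡ just x → p ≡ q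

  IsVar : Term Σ' 𝒳 → Set
  IsVar (var _)   = ⊤
  IsVar (app _ _) = ⊥

  record Rule : Set where
    field
      lhs rhs  : Term Σ' 𝒳
      lhs-nonvar : ¬ IsVar lhs
      vars⊆    : ∀ x → x ∈Var rhs → x ∈Var lhs

  LinearRule : Rule → Set
  LinearRule ρ = Linear (Rule.lhs ρ) × Linear (Rule.rhs ρ)

  -- Edges of t° : an edge labelled i from the vertex at p to the vertex at p·i
  data Edge : Term Σ' 𝒳 → Set where
    edgeHere  : ∀ {f ts} (i : Fin (arity f)) → Edge (app f ts)
    edgeUnder : ∀ {f ts} (i : Fin (arity f)) → Edge (ts i) → Edge (app f ts)

  esrc : ∀ {t} → Edge t → Pos t
  esrc (edgeHere i) = here
  esrc (edgeUnder i e) = under i (esrc e)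

  etgt : ∀ {t} → Edge t → Pos t
  etgt (edgeHere i) = under i here
  etgt (edgeUnder i e) = under i (etgt e)

  eidx : ∀ {t} → Edge t → ℕ
  eidx (edgeHere i) = toℕ i
  eidx (edgeUnder i e) = eidx e

-- The flat lattice Σ° = (Σ ⊎ ℕ⁺) ⊎ {⊥, ⊤}

data Lab (F : Set) : Set where
  bot : Lab F
  top : Lab F
  sym : F → Lab F
  num : ℕ → Lab F      -- num n denotes the positive natural n+1

data _⊑_ {F : Set} : Lab F → Lab F → Set where
  bot⊑ : ∀ {a} → bot ⊑ a
  ⊑top : ∀ {a} → a ⊑ top
  ⊑refl : ∀ {a} → a ⊑ a

record Graph (F : Set) : Set₁ where
  field
    V E : Set
    s t : E → V
    ℓV  : V → Lab F
    ℓE  : E → Lab F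
open Graph

record Hom {F : Set} (G H : Graph F) : Set where
  field
    φV : V G → V H
    φE : E G → E H
    s-comm : ∀ e → s H (φE e) ≡ φV (s G e)
    t-comm : ∀ e → t H (φE e) ≡ φV (t G e)
    ℓV-mono : ∀ v → ℓV G v ⊑ ℓV H (φV v)
    ℓE-mono : ∀ e → ℓE G e ⊑ ℓE H (φE e)
open Hom

module _ {F : Set} where
  idH : {G : Graph F} → Hom G G
  idH = record { φV = λ v → v ; φE = λ e → e ; s-comm = λ _ → refl ; t-comm = λ _ → refl
               ; ℓV-mono = λ _ → ⊑refl ; ℓE-mono = λ _ → ⊑refl }

  ⊑-trans : {a b c : Lab F} → a ⊑ b → b ⊑ c → a ⊑ c
  ⊑-trans bot⊑ _ = bot⊑
  ⊑-trans ⊑top ⊑top = ⊑top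
  ⊑-trans ⊑top ⊑refl = ⊑top
  ⊑-trans ⊑refl q = q

  trans' : {A : Set} {x y z : A} → x ≡ y → y ≡ z → x ≡ z
  trans' refl q = q

  _∘H_ : {G H K : Graph F} → Hom H K → Hom G H → Hom G K
  _∘H_ {G} {H} {K} g f = record
    { φV = λ v → φV g (φV f v)
    ; φE = λ e → φE g (φE f e)
    ; s-comm = λ e → trans' (s-comm g (φE f e)) (cong (φV g) (s-comm f e))
    ; t-comm = λ e → trans' (t-comm g (φE f e)) (cong (φV g) (t-comm f e))
    ; ℓV-mono = λ v → ⊑-trans (ℓV-mono f v) (ℓV-mono g (φV f v))
    ; ℓE-mono = λ e → ⊑-trans (ℓE-mono f e) (ℓE-mono g (φE f e))
    }

  _≈H_ : {G H : Graph F} → Hom G H → Hom G H → Set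
  f ≈H g = (∀ v → φV f v ≡ φV g v) × (∀ e → φE f e ≡ φE g e)

  Mono : {G H : Graph F} → Hom G H → Set₁
  Mono {G} {H} m = ∀ {X : Graph F} (f g : Hom X G) → (m ∘H f) ≈H (m ∘H g) → f ≈H g

  IsPullback : {P A B D : Graph F} (f : Hom P A) (g : Hom P B) (h : Hom A D) (k : Hom B D) → Set₁
  IsPullback {P} {A} {B} {D} f g h k =
    ((h ∘H f) ≈H (k ∘H g)) ×
    (∀ (X : Graph F) (f' : Hom X A) (g' : Hom X B) → (h ∘H f') ≈H (k ∘H g') →
       Σ (Hom X P) λ u → ((f ∘H u) ≈H f') × ((g ∘H u) ≈H g') ×
         (∀ (u' : Hom X P) → (f ∘H u') ≈H f' → (g ∘H u') ≈H g' → u' ≈H u))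

module Encoding {Σ' : Signature} {𝒳 : Set} where
  open Signature Σ'
  open Terms {Σ'} {𝒳}

  symLabel : Term Σ' 𝒳 → Lab Sym
  symLabel (var _)   = bot
  symLabel (app f _) = sym f

  _° : Term Σ' 𝒳 → Graph Sym
  t ° = record
    { V = Pos t ; E = Edge t ; s = esrc ; t = etgt
    ; ℓV = λ p → symLabel (subtermAt t p)
    ; ℓE = λ e → num (eidx e) }

  data CV (l : Term Σ' 𝒳) : Set where
    old   : Pos l → CV l
    prime : (p : Pos l) → T (isVarPos p) → CV l
    ctx   : CV l

  data CE (l : Term Σ' 𝒳) : Set where
    oldE   : Edge l → CE l
    toPrime : (p : Pos l) → T (isVarPos p) → CE l
    primeLoop : (p : Pos l) → T (isVarPos p) → CE l
    ctxRoot : CE l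
    ctxLoop : CE l

  closureLabel : Term Σ' 𝒳 → Lab Sym
  closureLabel (var _)   = top
  closureLabel (app f _) = sym f

  Ctx : Term Σ' 𝒳 → Graph Sym
  Ctx l = record
    { V = CV l ; E = CE l ; s = src ; t = tgt ; ℓV = lv ; ℓE = le }
    where
      src : CE l → CV l
      src (oldE e) = old (esrc e)
      src (toPrime p x) = old p
      src (primeLoop p x) = prime p x
      src ctxRoot = ctx
      src ctxLoop = ctx
      tgt : CE l → CV l
      tgt (oldE e) = old (etgt e)
      tgt (toPrime p x) = prime p x
      tgt (primeLoop p x) = prime p x
      tgt ctxRoot = old here
      tgt ctxLoop = ctx
      lv : CV l → Lab Sym
      lv (old p) = closureLabel (subtermAt l p)
      lv (prime _ _) = top
      lv ctx = top
      le : CE l → Lab Sym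
      le (oldE e) = num (eidx e)
      le _ = top

  label⊑ : (u : Term Σ' 𝒳) → symLabel u ⊑ closureLabel u
  label⊑ (var _) = bot⊑
  label⊑ (app _ _) = ⊑refl

  tL : (l : Term Σ' 𝒳) → Hom (l °) (Ctx l)
  tL l = record
    { φV = old ; φE = oldE ; s-comm = λ _ → refl ; t-comm = λ _ → refl
    ; ℓV-mono = λ p → label⊑ (subtermAt l p) ; ℓE-mono = λ _ → ⊑refl }

  -- m, together with some α, is part of a PBPO⁺ step (α ∘ m = t_L, pullback)
  IsMatchWitness : (l s : Term Σ' 𝒳) (m : Hom (l °) (s °)) (α : Hom (s °) (Ctx l)) → Set₁
  IsMatchWitness l s m α = ((α ∘H m) ≈H tL l) × IsPullback idH m (tL l) α

{-# OPTIONS --safe #-}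
-- Only uniqueness needs proof. The pullback condition forces α⁻¹(t_L q) = {m q},
-- so two witnesses agree wherever either of them lands in l°. Outside l° the
-- closure is rigid: a vertex of C[l°↓𝒳] has at most one successor outside l°,
-- and the root of s must go to 𝒞, since the path from it to m(ε) can only pass
-- through 𝒞. Propagating down the tree s° from its root, the two vertex maps
-- agree everywhere, and then so do the edge maps, C[l°↓𝒳] having no parallel
-- edges.
module Submission where

open import Defs hiding (sym)
open import Data.Bool.Properties using (T-irrelevant)
open import Data.Empty using (⊥)
open import Data.Maybe using (Maybe; just; nothing; map; maybe′)
open import Data.Maybe.Properties using (just-injective)
open import Data.Product using (Σ; _×_; _,_; proj₁)
open import Data.Sum using (_⊎_; inj₁; inj₂)
open import Data.Unit using (⊤; tt)
open import Relation.Binary.PropositionalEquality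
  using (_≡_; refl; sym; trans; cong; cong₂; subst)

open Graph
open Hom

module _ {F : Set} where

  point : Graph F
  point = record { V = ⊤ ; E = ⊥ ; s = λ () ; t = λ () ; ℓV = λ _ → bot ; ℓE = λ () }

  pointAt : {G : Graph F} → V G → Hom point G
  pointAt v = record { φV = λ _ → v ; φE = λ () ; s-comm = λ () ; t-comm = λ ()
                     ; ℓV-mono = λ _ → bot⊑ ; ℓE-mono = λ () }

  pullback-vertex : {P A B D : Graph F} {f : Hom P A} {g : Hom P B} {h : Hom A D} {k : Hom B D} →
                    IsPullback f g h k → ∀ a b → φV h a ≡ φV k b →
                    Σ (V P) λ x → φV f x ≡ a × φV g x ≡ b
  pullback-vertex (_ , universal) a b eq
    with universal point (pointAt a) (pointAt b) ((λ _ → eq) , λ ())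
  ... | u , (fu≈a , _) , (gu≈b , _) , _ = φV u tt , fu≈a tt , gu≈b tt

module TermGraph {Σ' : Signature} {𝒳 : Set} where
  open Terms {Σ'} {𝒳}

  propagate-down : ∀ {t} (P : Pos t → Set) → (∀ e → P (esrc e) → P (etgt e)) →
                   P here → ∀ q → P q
  propagate-down P step root here = root
  propagate-down {app f ts} P step root (under i q) =
    propagate-down (λ q → P (under i q)) (λ e → step (edgeUnder i e)) (step (edgeHere i) root) q

  propagate-up : ∀ {t} (P : Pos t → Set) → (∀ e → P (etgt e) → P (esrc e)) →
                 ∀ q → P q → P here
  propagate-up P step here h = h
  propagate-up {app f ts} P step (under i q) h =
    step (edgeHere i) (propagate-up (λ q → P (under i q)) (λ e → step (edgeUnder i e)) q h)

  parentEdge : ∀ {t} → Pos t → Maybe (Edge t)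
  parentEdge here = nothing
  parentEdge (under i q) = just (maybe′ (edgeUnder i) (edgeHere i) (parentEdge q))

  parentEdge-etgt : ∀ {t} (e : Edge t) → parentEdge (etgt e) ≡ just e
  parentEdge-etgt (edgeHere i) = refl
  parentEdge-etgt (edgeUnder i e) rewrite parentEdge-etgt e = refl

module Closure {Σ' : Signature} {𝒳 : Set} (l : Term Σ' 𝒳) where
  open Terms {Σ'} {𝒳}
  open Encoding {Σ'} {𝒳}
  open TermGraph

  NotOld : CV l → Set
  NotOld (old _) = ⊥
  NotOld _       = ⊤

  isOld : (c : CV l) → Σ (Pos l) (λ q → c ≡ old q) ⊎ NotOld c
  isOld (old q)     = inj₁ (q , refl)
  isOld (prime _ _) = inj₂ tt
  isOld ctx         = inj₂ tt

  edgeBetween : CV l → CV l → Maybe (CE l)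
  edgeBetween (old _)     (old q)     = map oldE (parentEdge q)
  edgeBetween (old _)     (prime q x) = just (toPrime q x)
  edgeBetween (prime _ _) (prime q x) = just (primeLoop q x)
  edgeBetween ctx         (old _)     = just ctxRoot
  edgeBetween ctx         ctx         = just ctxLoop
  edgeBetween _           _           = nothing

  edgeBetween-ends : ∀ e → edgeBetween (s (Ctx l) e) (t (Ctx l) e) ≡ just e
  edgeBetween-ends (oldE e)        = cong (map oldE) (parentEdge-etgt e)
  edgeBetween-ends (toPrime _ _)   = refl
  edgeBetween-ends (primeLoop _ _) = refl
  edgeBetween-ends ctxRoot         = refl
  edgeBetween-ends ctxLoop         = refl

  edge-unique : ∀ e₁ e₂ → s (Ctx l) e₁ ≡ s (Ctx l) e₂ → t (Ctx l) e₁ ≡ t (Ctx l) e₂ → e₁ ≡ e₂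
  edge-unique e₁ e₂ s≡ t≡ = just-injective
    (trans (sym (edgeBetween-ends e₁)) (trans (cong₂ edgeBetween s≡ t≡) (edgeBetween-ends e₂)))

  outside-successor-unique : ∀ e₁ e₂ → s (Ctx l) e₁ ≡ s (Ctx l) e₂ →
    NotOld (t (Ctx l) e₁) → NotOld (t (Ctx l) e₂) → t (Ctx l) e₁ ≡ t (Ctx l) e₂
  outside-successor-unique (oldE _) _ _ () _
  outside-successor-unique ctxRoot  _ _ () _
  outside-successor-unique _ (oldE _) _ _ ()
  outside-successor-unique _ ctxRoot  _ _ ()
  outside-successor-unique (toPrime p x) (toPrime .p y) refl _ _ = cong (prime p) (T-irrelevant x y)
  outside-successor-unique (primeLoop p x) (primeLoop .p .x) refl _ _ = refl
  outside-successor-unique ctxLoop ctxLoop _ _ _ = refl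
  outside-successor-unique (toPrime _ _)   (primeLoop _ _) () _ _
  outside-successor-unique (toPrime _ _)   ctxLoop         () _ _
  outside-successor-unique (primeLoop _ _) (toPrime _ _)   () _ _
  outside-successor-unique (primeLoop _ _) ctxLoop         () _ _
  outside-successor-unique ctxLoop         (toPrime _ _)   () _ _
  outside-successor-unique ctxLoop         (primeLoop _ _) () _ _

  RootOrCtx : CV l → Set
  RootOrCtx (old here)        = ⊤
  RootOrCtx (old (under _ _)) = ⊥
  RootOrCtx (prime _ _)       = ⊥
  RootOrCtx ctx               = ⊤

  into-RootOrCtx-from-ctx : ∀ e → RootOrCtx (t (Ctx l) e) → s (Ctx l) e ≡ ctx
  into-RootOrCtx-from-ctx (oldE (edgeHere _))    ()
  into-RootOrCtx-from-ctx (oldE (edgeUnder _ _)) ()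
  into-RootOrCtx-from-ctx ctxRoot _ = refl
  into-RootOrCtx-from-ctx ctxLoop _ = refl

  RootOrCtx-NotOld : ∀ c → RootOrCtx c → NotOld c → c ≡ ctx
  RootOrCtx-NotOld ctx _ _ = refl

module Uniqueness {Σ' : Signature} {𝒳 : Set} (l u : Term Σ' 𝒳) (m : Hom (Encoding._° l) (Encoding._° u)) where
  open Terms {Σ'} {𝒳}
  open Encoding {Σ'} {𝒳}
  open TermGraph
  open Closure l

  Witness : Set₁
  Witness = Σ (Hom (u °) (Ctx l)) (IsMatchWitness l u m)

  preimage-old : ((α , _) : Witness) → ∀ v q → φV α v ≡ old q → v ≡ φV m q
  preimage-old (α , _ , pb) v q eq with pullback-vertex {f = idH} {m} {tL l} {α} pb q v (sym eq)
  ... | x , x≡q , mx≡v = trans (sym mx≡v) (cong (φV m) x≡q)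

  old-transfer : ((α , _) (α' , _) : Witness) → ∀ v q → φV α v ≡ old q → φV α' v ≡ old q
  old-transfer w@(α , _) (α' , α'm≈tL , _) v q eq =
    trans (cong (φV α') (preimage-old w v q eq)) (proj₁ α'm≈tL q)

  root-RootOrCtx : ((α , _) : Witness) → RootOrCtx (φV α here)
  root-RootOrCtx (α , αm≈tL , _) =
    propagate-up (λ v → RootOrCtx (φV α v)) pred (φV m here)
      (subst RootOrCtx (sym (proj₁ αm≈tL here)) tt)
    where
      pred : ∀ e → RootOrCtx (φV α (etgt e)) → RootOrCtx (φV α (esrc e))
      pred e h = subst RootOrCtx (sym src≡ctx) tt
        where
          src≡ctx : φV α (esrc e) ≡ ctx
          src≡ctx = trans (sym (s-comm α e))
            (into-RootOrCtx-from-ctx (φE α e) (subst RootOrCtx (sym (t-comm α e)) h))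

  module _ (w w' : Witness) where
    private
      α α' : Hom (u °) (Ctx l)
      α  = proj₁ w
      α' = proj₁ w'

    agree-or-outside : ∀ v → φV α' v ≡ φV α v ⊎ (NotOld (φV α v) × NotOld (φV α' v))
    agree-or-outside v with isOld (φV α v) | isOld (φV α' v)
    ... | inj₁ (q , eq) | _              = inj₁ (trans (old-transfer w w' v q eq) (sym eq))
    ... | inj₂ _        | inj₁ (q , eq') = inj₁ (trans eq' (sym (old-transfer w' w v q eq')))
    ... | inj₂ n        | inj₂ n'        = inj₂ (n , n')

    agree-at-root : φV α' here ≡ φV α here
    agree-at-root with agree-or-outside here
    ... | inj₁ eq = eq
    ... | inj₂ (n , n') = trans (RootOrCtx-NotOld _ (root-RootOrCtx w') n')
                                (sym (RootOrCtx-NotOld _ (root-RootOrCtx w) n))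

    agree-along-edge : ∀ e → φV α' (esrc e) ≡ φV α (esrc e) → φV α' (etgt e) ≡ φV α (etgt e)
    agree-along-edge e h with agree-or-outside (etgt e)
    ... | inj₁ eq = eq
    ... | inj₂ (n , n') =
      trans (sym (t-comm α' e))
        (trans (outside-successor-unique (φE α' e) (φE α e)
                  (trans (s-comm α' e) (trans h (sym (s-comm α e))))
                  (subst NotOld (sym (t-comm α' e)) n')
                  (subst NotOld (sym (t-comm α e)) n))
               (t-comm α e))

    agree-vertices : ∀ v → φV α' v ≡ φV α v
    agree-vertices = propagate-down _ agree-along-edge agree-at-root

    agree-edges : ∀ e → φE α' e ≡ φE α e
    agree-edges e = edge-unique _ _
      (trans (s-comm α' e) (trans (agree-vertices (esrc e)) (sym (s-comm α e))))
      (trans (t-comm α' e) (trans (agree-vertices (etgt e)) (sym (t-comm α e))))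

proposition30 : (Σ' : Signature) (𝒳 : Set) (ρ : Terms.Rule {Σ'} {𝒳}) → Terms.LinearRule ρ → (s : Term Σ' 𝒳) → Terms.Linear s → (p : Terms.Pos s) → (m : Hom (Encoding._° (Terms.Rule.lhs ρ)) (Encoding._° s)) → Mono m → Hom.φV m Terms.here ≡ p → Σ (Hom (Encoding._° s) (Encoding.Ctx (Terms.Rule.lhs ρ))) (Encoding.IsMatchWitness (Terms.Rule.lhs ρ) s m) → Σ (Hom (Encoding._° s) (Encoding.Ctx (Terms.Rule.lhs ρ))) (λ α → Encoding.IsMatchWitness (Terms.Rule.lhs ρ) s m α × ((α' : Hom (Encoding._° s) (Encoding.Ctx (Terms.Rule.lhs ρ))) → Encoding.IsMatchWitness (Terms.Rule.lhs ρ) s m α' → α' ≈H α))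
proposition30 Σ' 𝒳 ρ _ s _ _ m _ _ w@(α , isWitness) =
  α , isWitness , λ α' w' → agree-vertices w (α' , w') , agree-edges w (α' , w')
  where open Uniqueness (Terms.Rule.lhs ρ) s m
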